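{- Let $a,b$ be relatively prime integers with $1<a<b$, let $S=\langle a,b\rangle$, let $(u,v)$ be the definitely least solution of $ax+by=1$, and let $\alpha:T(S)\to I(S)$ be the bijection $\alpha(x)=F(S)-x$. Then \[\#\{\alpha^{ -1}(I_{i,a}(S)) : I_{i,a}(S)\neq\varnothing,\ i\in[1,a-1]\}=|v|.\]
   Context: $\langle a,b\rangle=\{\lambda_1a+\lambda_2b:\lambda_1,\lambda_2\in\mathbb{N}\}$. $F(S)$ is the largest integer not in $S$. $I(S)$ is the set of isolated gaps of $S$ (elements $x\in\mathbb{N}\setminus S$ with $x-1,x+1\in S$). $T(S)=\{s\in S: s<F(S),\ s-1\notin S,\ s+1\notin S\}$; $\alpha(x)=F(S)-x$ is a bijection $T(S)\to I(S)$ since $S$ is symmetric. For $i\in\{1,\dots,a-1\}$, $I_{i,a}(S)=\{s\in I(S): s\equiv i\pmod a\}$. The definitely least solution $(u,v)$ of $ax+by=1$ is the integer solution for which both $|u|$ and $|v|$ are least possible; it is unique, and is the unique solution with $|u|\le b/2$, $|v|\le a/2$. -}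

module Defs where

open import Data.Bool using (Bool; true; false; _∧_; _∨_; not; T)
open import Data.Nat using (ℕ; zero; suc; _+_; _*_; _∸_; _≤ᵇ_; _<ᵇ_; _≡ᵇ_; _%_; _<_; _≤_; NonZero)
open import Data.Nat.Divisibility using (_∣?_)
open import Data.Bool.ListAction using (any)
open import Data.List using (List; []; _∷_; filterᵇ; upTo; map; deduplicate; length; null)
import Data.List.Properties as LP
import Data.Nat.Properties as NP
open import Data.Integer using (ℤ; +_; ∣_∣) renaming (_+_ to _+ℤ_; _*_ to _*ℤ_)
open import Data.Product using (_×_)
open import Data.Empty using (⊥)
open import Relation.Nullary using (¬_)
open import Relation.Nullary.Decidable using (isYes)
open import Relation.Binary.PropositionalEquality using (_≡_)

-- Membership in S = ⟨a,b⟩ = {λ₁ a + λ₂ b : λ₁, λ₂ ∈ ℕ}.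
-- n ∈ S iff some λ₁ with λ₁ a ≤ n has b ∣ (n - λ₁ a); λ₁ ≤ n suffices for a ≥ 1.
inSᵇ : ℕ → ℕ → ℕ → Bool
inSᵇ a b n = any (λ k → (k * a ≤ᵇ n) ∧ isYes (b ∣? (n ∸ k * a))) (upTo (suc n))

InS : ℕ → ℕ → ℕ → Set
InS a b n = T (inSᵇ a b n)

IsFrobenius : ℕ → ℕ → ℕ → Set
IsFrobenius a b F = (¬ InS a b F) × ((n : ℕ) → F < n → InS a b n)

-- x ∈ I(S): x ∉ S, x-1 ∈ S, x+1 ∈ S  (x = 0 is never a gap since 0 ∈ S).
isIsolatedGapᵇ : ℕ → ℕ → ℕ → Bool
isIsolatedGapᵇ a b zero = false
isIsolatedGapᵇ a b (suc x) = not (inSᵇ a b (suc x)) ∧ inSᵇ a b x ∧ inSᵇ a b (suc (suc x))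

-- s ∈ T(S): s ∈ S, s < F, s-1 ∉ S (automatic for s = 0 since -1 ∉ S), s+1 ∉ S.
predNotInSᵇ : ℕ → ℕ → ℕ → Bool
predNotInSᵇ a b zero = true
predNotInSᵇ a b (suc s) = not (inSᵇ a b s)

isTᵇ : ℕ → ℕ → ℕ → ℕ → Bool
isTᵇ a b F s = inSᵇ a b s ∧ (s <ᵇ F) ∧ predNotInSᵇ a b s ∧ not (inSᵇ a b (suc s))

-- I_{i,a}(S) as the increasing list of its elements (all gaps are ≤ F).
I-ia : (a b F : ℕ) → .{{_ : NonZero a}} → ℕ → List ℕ
I-ia a b F i = filterᵇ (λ x → isIsolatedGapᵇ a b x ∧ (x % a ≡ᵇ i)) (upTo (suc F))

-- α⁻¹(I_{i,a}(S)) = {s ∈ T(S) : α(s) = F - s ∈ I_{i,a}(S)}, as increasing list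
-- (elements of T(S) are < F).
alphaInv-Iia : (a b F : ℕ) → .{{_ : NonZero a}} → ℕ → List ℕ
alphaInv-Iia a b F i =
  filterᵇ (λ s → isTᵇ a b F s ∧ isIsolatedGapᵇ a b (F ∸ s) ∧ ((F ∸ s) % a ≡ᵇ i)) (upTo F)

range1 : ℕ → List ℕ
range1 a = filterᵇ (λ i → 1 ≤ᵇ i) (upTo a)

-- The set {α⁻¹(I_{i,a}(S)) : I_{i,a}(S) ≠ ∅, i ∈ [1,a-1]} as a duplicate-free list of
-- subsets (each subset is an increasing list, so set equality = list equality).
alphaInvFamily : (a b F : ℕ) → .{{_ : NonZero a}} → List (List ℕ)
alphaInvFamily a b F =
  deduplicate (LP.≡-dec NP._≟_)
    (map (alphaInv-Iia a b F) (filterᵇ (λ i → not (null (I-ia a b F i))) (range1 a)))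

IsDefinitelyLeast : ℕ → ℕ → ℤ → ℤ → Set
IsDefinitelyLeast a b u v =
  ((+ a) *ℤ u +ℤ (+ b) *ℤ v ≡ + 1) ×
  ((x y : ℤ) → (+ a) *ℤ x +ℤ (+ b) *ℤ y ≡ + 1 → (∣ u ∣ ≤ ∣ x ∣) × (∣ v ∣ ≤ ∣ y ∣))

{-# OPTIONS --safe #-}
module Submission where

-- Let c ∈ [1, a) be the inverse of b modulo a. Every gap of S = ⟨a, b⟩ is t b − (k + 1) a
-- with 0 ≤ t < a, and its residue t b mod a determines t. Using 1 = b c − d a, an isolated gap
-- has max(c, a − c) ≤ t, and conversely t b − a is an isolated gap for each such t; hence
-- I_{i,a}(S) ≠ ∅ for exactly a − max(c, a − c) = min(c, a − c) residues i. Since S is symmetric,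
-- F − x ∈ T(S) for every isolated gap x, so these α⁻¹(I_{i,a}(S)) are nonempty, and they are
-- pairwise distinct because each of their elements s recovers i as (F − s) mod a. Finally the
-- definitely least solution has v = c if c ≤ a − c and v = c − a otherwise, so |v| = min(c, a − c).

open import Defs
open import Data.Bool using (Bool; true; false; T; not; _∧_)
open import Data.Bool.Properties using (T-∧)
open import Data.Empty using (⊥; ⊥-elim)
open import Data.Integer using (ℤ; ∣_∣)
open import Data.List using (List; []; _∷_; length; map; upTo; applyUpTo; filterᵇ; null)
open import Data.List.Membership.Propositional using (_∈_; find; lose)
open import Data.List.Membership.Propositional.Properties
  using (∈-upTo⁺; ∈-upTo⁻; ∈-filter⁺; ∈-filter⁻; ∈-applyUpTo⁺; ∈-applyUpTo⁻
        ; ∈-deduplicate⁺; ∈-deduplicate⁻)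
open import Data.List.Membership.Propositional.Properties.WithK using (unique∧set⇒bag)
open import Data.List.Properties using (length-applyUpTo; length-map; map-∘; map-id-local; ≡-dec)
open import Data.List.Relation.Binary.BagAndSetEquality using (∼bag⇒↭)
open import Data.List.Relation.Binary.Permutation.Propositional.Properties using (↭-length)
import Data.List.Relation.Unary.All as All
open import Data.List.Relation.Unary.Any using (here)
open import Data.List.Relation.Unary.Any.Properties using (any⁺; any⁻)
open import Data.List.Relation.Unary.Unique.Propositional using (Unique)
import Data.List.Relation.Unary.Unique.Propositional.Properties as Unique
open import Data.Nat
  using (ℕ; zero; suc; pred; _+_; _*_; _∸_; _≤_; _<_; s≤s; s≤s⁻¹; z<s; NonZero; _%_; _/_; _⊔_; _⊓_
        ; _≤ᵇ_; _≡ᵇ_; _≤?_; +-rawMagma)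
open import Algebra.Definitions.RawMagma +-rawMagma using (_,_) -- the constructor of _≤″_
open import Data.Nat.Base using (>-nonZero; >-nonZero⁻¹; ≢-nonZero)
open import Data.Nat.Coprimality using (Coprime; coprime-divisor)
open import Data.Nat.DivMod
  using (m≡m%n+[m/n]*n; m%n<n; m%n%n≡m%n; %-distribˡ-*; [m+n]%n≡m%n; [m+kn]%n≡m%n; m<n⇒m%n≡m)
open import Data.Nat.Divisibility using (_∣_; divides; _∣?_; ∣m+n∣m⇒∣n; n∣m*n; >⇒∤)
open import Data.Nat.Properties
open import Data.List.Relation.Unary.Unique.DecPropositional.Properties (≡-dec _≟_) using (deduplicate-!)
open import Data.Nat.Tactic.RingSolver using (solve-∀)
open import Data.Product using (∃; ∃₂; _×_; _,_; proj₁; proj₂)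
open import Data.Sum using (inj₁; inj₂; [_,_]′)
open import Function using (_∘_; _⇔_; mk⇔; Equivalence)
open Equivalence using (to; from)
open import Relation.Nullary using (¬_; Dec; yes; no; contradiction)
open import Relation.Nullary.Decidable using (T?; fromWitness; toWitness)
open import Relation.Binary.PropositionalEquality
  using (_≡_; _≢_; refl; sym; trans; cong; cong₂; subst; module ≡-Reasoning)

unique∧set⇒length≡ : {A : Set} {xs ys : List A} → Unique xs → Unique ys →
  (∀ {z} → z ∈ xs ⇔ z ∈ ys) → length xs ≡ length ys
unique∧set⇒length≡ xs! ys! xs≈ys = ↭-length (∼bag⇒↭ (unique∧set⇒bag xs! ys! xs≈ys))

T-∧³ : ∀ {x y z} → T (x ∧ y ∧ z) ⇔ (T x × T y × T z)
T-∧³ = mk⇔ (λ t → let tx , tyz = to T-∧ t in tx , to T-∧ tyz)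
           (λ (tx , ty , tz) → from T-∧ (tx , from T-∧ (ty , tz)))

T-not : ∀ {x} → T (not x) ⇔ (¬ T x)
T-not {false} = mk⇔ (λ _ ()) _
T-not {true} = mk⇔ (λ ()) (λ ¬t → ¬t _)

T-not-null : {A : Set} {xs : List A} → T (not (null xs)) ⇔ ∃ (_∈ xs)
T-not-null {xs = []} = mk⇔ (λ ()) (λ ())
T-not-null {xs = x ∷ _} = mk⇔ (λ _ → x , here refl) _

∈-filterᵇ : {A : Set} (p : A → Bool) {xs : List A} {x : A} → x ∈ filterᵇ p xs ⇔ (x ∈ xs × T (p x))
∈-filterᵇ p = mk⇔ (∈-filter⁻ (T? ∘ p)) (λ (x∈xs , px) → ∈-filter⁺ (T? ∘ p) x∈xs px)

[m+n]%o≡m%o⇒o∣n : ∀ m n o .⦃ _ : NonZero o ⦄ → (m + n) % o ≡ m % o → o ∣ n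
[m+n]%o≡m%o⇒o∣n m n o [m+n]%o≡m%o = ∣m+n∣m⇒∣n o∣[m/o]*o+n (n∣m*n (m / o))
  where
  open ≡-Reasoning
  o∣[m/o]*o+n : o ∣ m / o * o + n
  o∣[m/o]*o+n = divides ((m + n) / o) (+-cancelˡ-≡ (m % o) _ _ (begin
    m % o + (m / o * o + n)       ≡⟨ sym (+-assoc (m % o) _ n) ⟩
    m % o + m / o * o + n         ≡⟨ cong (_+ n) (sym (m≡m%n+[m/n]*n m o)) ⟩
    m + n                         ≡⟨ m≡m%n+[m/n]*n (m + n) o ⟩
    (m + n) % o + (m + n) / o * o ≡⟨ cong (_+ (m + n) / o * o) [m+n]%o≡m%o ⟩
    m % o + (m + n) / o * o       ∎))

module DefinitelyLeast where

  open import Data.Integer using (+_; -[1+_]; -_; _⊖_) renaming (_+_ to _+ℤ_; _*_ to _*ℤ_; _-_ to _-ℤ_)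
  open import Data.Integer.Properties using (+-injective; pos-*; ∣⊖∣-≤; ⊖-≥; m-n≡m⊖n; ∣m⊖n∣≡∣n⊖m∣)
    renaming (+-comm to +ℤ-comm)
  import Data.Integer.Tactic.RingSolver as ℤ-Solver

  n≤∣n⊖a∣⇒n≤a∸n : ∀ {n a} → 0 < a → n ≤ ∣ n ⊖ a ∣ → n ≤ a ∸ n
  n≤∣n⊖a∣⇒n≤a∸n {n} {a} 0<a n≤∣n⊖a∣ with n ≤? a
  ... | yes n≤a = subst (n ≤_) (∣⊖∣-≤ n≤a) n≤∣n⊖a∣
  ... | no n≰a =
    contradiction (subst (n ≤_) (cong ∣_∣ (⊖-≥ a≤n)) n≤∣n⊖a∣) (<⇒≱ (∸-monoʳ-< 0<a a≤n))
    where
    a≤n : a ≤ n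
    a≤n = <⇒≤ (≰⇒> n≰a)

  x[-p]+yn≡1⇒yn≡1+px : ∀ x y p n → + x *ℤ - (+ p) +ℤ + y *ℤ + n ≡ + 1 → y * n ≡ 1 + p * x
  x[-p]+yn≡1⇒yn≡1+px x y p n eq = +-injective (begin
    + (y * n)                                 ≡⟨ pos-* y n ⟩
    + y *ℤ + n                                ≡⟨ move (+ x) (+ p) (+ y *ℤ + n) ⟩
    (+ x *ℤ - (+ p) +ℤ + y *ℤ + n) +ℤ + x *ℤ + p ≡⟨ cong₂ _+ℤ_ eq (sym (pos-* x p)) ⟩
    + (1 + x * p)                              ≡⟨ cong (λ z → + (1 + z)) (*-comm x p) ⟩
    + (1 + p * x)                              ∎)
    where
    open ≡-Reasoning
    move : ∀ X P Z → Z ≡ (X *ℤ - P +ℤ Z) +ℤ X *ℤ P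
    move = ℤ-Solver.solve-∀

  a*m+b*n≢1 : ∀ {a b} → 1 < a → 1 < b → ∀ m n → a * m + b * n ≢ 1
  a*m+b*n≢1 {a} {b} 1<a 1<b (suc m) n eq =
    <⇒≱ 1<a (≤-trans (m≤m*n a (suc m)) (≤-trans (m≤m+n _ (b * n)) (≤-reflexive eq)))
  a*m+b*n≢1 {a} {b} 1<a 1<b zero (suc n) eq =
    <⇒≱ 1<b (≤-trans (m≤m*n b (suc n)) (≤-trans (m≤n+m _ (a * 0)) (≤-reflexive eq)))
  a*m+b*n≢1 {a} {b} 1<a 1<b zero zero eq =
    0≢1+n (trans (sym (cong₂ _+_ (*-zeroʳ a) (*-zeroʳ b))) eq)

  a*m≡1+n*b⇒b*c≡1+d*a : ∀ {a b c d m n} → c + n ≡ a → m + d ≡ b →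
    a * m ≡ 1 + n * b → b * c ≡ 1 + d * a
  a*m≡1+n*b⇒b*c≡1+d*a {c = c} {d} {m} {n} refl refl eq = +-cancelʳ-≡ ((m + d) * n) _ _ (begin
    (m + d) * c + (m + d) * n           ≡⟨ regroup₁ m d c n ⟩
    (c + n) * m + d * (c + n)           ≡⟨ cong (_+ d * (c + n)) eq ⟩
    (1 + n * (m + d)) + d * (c + n)     ≡⟨ regroup₂ m d c n ⟩
    (1 + d * (c + n)) + (m + d) * n     ∎)
    where
    open ≡-Reasoning
    regroup₁ : ∀ m d c n → (m + d) * c + (m + d) * n ≡ (c + n) * m + d * (c + n)
    regroup₁ = solve-∀
    regroup₂ : ∀ m d c n → (1 + n * (m + d)) + d * (c + n) ≡ (1 + d * (c + n)) + (m + d) * n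
    regroup₂ = solve-∀

  -- Minimality against the solutions (u + b, v − a) and (u − b, v + a) gives |v| ≤ a − |v|.
  definitelyLeast⇒inverse : ∀ {a b u v} → 1 < a → 1 < b → IsDefinitelyLeast a b u v →
    ∃₂ λ c d → c < a × b * c ≡ 1 + d * a × ∣ v ∣ ≡ c ⊓ (a ∸ c)
  definitelyLeast⇒inverse {a} {b} {+ m} {+ n} 1<a 1<b (eq , _) =
    ⊥-elim (a*m+b*n≢1 1<a 1<b m n
      (+-injective (trans (cong₂ _+ℤ_ (pos-* a m) (pos-* b n)) eq)))
  definitelyLeast⇒inverse {a} {b} { -[1+ p ]} { -[1+ n ]} 1<a 1<b (eq , _) =
    ⊥-elim (-+≢+1 (a * suc p + b * suc n) (trans (cong -_ (cong₂ _+ℤ_ (pos-* a (suc p)) (pos-* b (suc n))))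
      (trans (sym (negate (+ a) (+ suc p) (+ b) (+ suc n))) eq)))
    where
    negate : ∀ A P B N → A *ℤ - P +ℤ B *ℤ - N ≡ - (A *ℤ P +ℤ B *ℤ N)
    negate = ℤ-Solver.solve-∀
    -+≢+1 : ∀ k → - (+ k) ≢ + 1
    -+≢+1 zero ()
    -+≢+1 (suc k) ()
  definitelyLeast⇒inverse {a} {b} { -[1+ p ]} {+ n} 1<a 1<b (eq , least) =
    n , suc p , n<a , bn≡1+[p+1]a , sym (m≤n⇒m⊓n≡m n≤a∸n)
    where
    shift : ∀ A B u v → A *ℤ (u +ℤ B) +ℤ B *ℤ (v -ℤ A) ≡ A *ℤ u +ℤ B *ℤ v
    shift = ℤ-Solver.solve-∀
    bn≡1+[p+1]a : b * n ≡ 1 + suc p * a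
    bn≡1+[p+1]a = x[-p]+yn≡1⇒yn≡1+px a b (suc p) n eq
    n≤a∸n : n ≤ a ∸ n
    n≤a∸n = n≤∣n⊖a∣⇒n≤a∸n (<-trans z<s 1<a)
      (subst (n ≤_) (cong ∣_∣ (m-n≡m⊖n n a)) (proj₂ (least _ _ (trans (shift (+ a) (+ b) -[1+ p ] (+ n)) eq))))
    n≢0 : n ≢ 0
    n≢0 refl = 0≢1+n (trans (sym (*-zeroʳ b)) bn≡1+[p+1]a)
    n<a : n < a
    n<a = m∸n≢0⇒n<m (λ a∸n≡0 → n≢0 (n≤0⇒n≡0 (subst (n ≤_) a∸n≡0 n≤a∸n)))
  definitelyLeast⇒inverse {a} {b} {+ m} { -[1+ n ]} 1<a 1<b (eq , least) =
    a ∸ suc n , b ∸ m , a∸[n+1]<a ,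
    a*m≡1+n*b⇒b*c≡1+d*a (m∸n+n≡m (<⇒≤ n+1<a)) (m+[n∸m]≡n (<⇒≤ m<b)) am≡1+[n+1]b , ∣v∣≡min
    where
    shift : ∀ A B u v → A *ℤ (u -ℤ B) +ℤ B *ℤ (v +ℤ A) ≡ A *ℤ u +ℤ B *ℤ v
    shift = ℤ-Solver.solve-∀
    am≡1+[n+1]b : a * m ≡ 1 + suc n * b
    am≡1+[n+1]b = x[-p]+yn≡1⇒yn≡1+px b a (suc n) m (trans (+ℤ-comm (+ b *ℤ -[1+ n ]) (+ a *ℤ + m)) eq)
    n+1≤a∸[n+1] : suc n ≤ a ∸ suc n
    n+1≤a∸[n+1] = n≤∣n⊖a∣⇒n≤a∸n (<-trans z<s 1<a)
      (subst (suc n ≤_) (∣m⊖n∣≡∣n⊖m∣ a (suc n))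
        (proj₂ (least _ _ (trans (shift (+ a) (+ b) (+ m) -[1+ n ]) eq))))
    n+1<a : suc n < a
    n+1<a = m∸n≢0⇒n<m (λ a∸[n+1]≡0 → 1+n≢0 (n≤0⇒n≡0 (subst (suc n ≤_) a∸[n+1]≡0 n+1≤a∸[n+1])))
    a∸[n+1]<a : a ∸ suc n < a
    a∸[n+1]<a = ∸-monoʳ-< z<s (<⇒≤ n+1<a)
    m<b : m < b
    m<b = *-cancelˡ-< a m b (begin-strict
      a * m             ≡⟨ am≡1+[n+1]b ⟩
      1 + suc n * b     <⟨ +-monoˡ-< (suc n * b) 1<b ⟩
      suc (suc n) * b   ≤⟨ *-monoˡ-≤ b n+1<a ⟩
      a * b             ∎)
      where open ≤-Reasoning
    ∣v∣≡min : suc n ≡ (a ∸ suc n) ⊓ (a ∸ (a ∸ suc n))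
    ∣v∣≡min = trans (sym (m≥n⇒m⊓n≡n n+1≤a∸[n+1]))
      (cong ((a ∸ suc n) ⊓_) (sym (m∸[m∸n]≡n (<⇒≤ n+1<a))))

open DefinitelyLeast using (definitelyLeast⇒inverse)

∈-range1 : ∀ {a i} → i ∈ range1 a ⇔ (1 ≤ i × i < a)
∈-range1 {a} {i} = mk⇔
  (λ i∈range → let i∈upTo , 1≤i = to (∈-filterᵇ (1 ≤ᵇ_)) i∈range
               in ≤ᵇ⇒≤ 1 i 1≤i , ∈-upTo⁻ i∈upTo)
  (λ (1≤i , i<a) → from (∈-filterᵇ (1 ≤ᵇ_)) (∈-upTo⁺ i<a , ≤⇒≤ᵇ 1≤i))

module Semigroup (a b : ℕ) .⦃ _ : NonZero a ⦄ where

  inS-intro : ∀ k j → InS a b (k * a + j * b)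
  inS-intro k j = any⁺ _ (lose (∈-upTo⁺ (s≤s k≤n)) (from T-∧ (≤⇒≤ᵇ ka≤n , fromWitness b∣n∸ka)))
    where
    ka≤n : k * a ≤ k * a + j * b
    ka≤n = m≤m+n (k * a) (j * b)
    k≤n : k ≤ k * a + j * b
    k≤n = ≤-trans (m≤m*n k a) ka≤n
    b∣n∸ka : b ∣ k * a + j * b ∸ k * a
    b∣n∸ka = divides j (m+n∸m≡n (k * a) (j * b))

  inS-elim : ∀ {n} → InS a b n → ∃₂ λ k j → n ≡ k * a + j * b
  inS-elim {n} n∈S with find (any⁻ _ (upTo (suc n)) n∈S)
  ... | k , _ , cond with to T-∧ cond
  ... | ka≤n , b∣ with toWitness {a? = b ∣? (n ∸ k * a)} b∣
  ... | divides j eq = k , j , trans (sym (m+[n∸m]≡n (≤ᵇ⇒≤ (k * a) n ka≤n))) (cong (k * a +_) eq)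

  inS-+ : ∀ {m n} → InS a b m → InS a b n → InS a b (m + n)
  inS-+ m∈S n∈S with inS-elim m∈S | inS-elim n∈S
  ... | k , j , refl | k' , j' , refl =
    subst (InS a b) (sym (regroup k a j b k' j')) (inS-intro (k + k') (j + j'))
    where
    regroup : ∀ k a j b k' j' → k * a + j * b + (k' * a + j' * b) ≡ (k + k') * a + (j + j') * b
    regroup = solve-∀

  ∉S⇒≤F : ∀ {F x} → IsFrobenius a b F → ¬ InS a b x → x ≤ F
  ∉S⇒≤F (_ , >F⇒∈S) x∉S = ≮⇒≥ (λ F<x → x∉S (>F⇒∈S _ F<x))

  IsolatedGap : ℕ → Set
  IsolatedGap zero = ⊥
  IsolatedGap (suc x) = InS a b x × ¬ InS a b (suc x) × InS a b (suc (suc x))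

  T-isIsolatedGapᵇ : ∀ {x} → T (isIsolatedGapᵇ a b x) ⇔ IsolatedGap x
  T-isIsolatedGapᵇ {zero} = mk⇔ (λ ()) (λ ())
  T-isIsolatedGapᵇ {suc x} = mk⇔
    (λ gap → let x+1∉S , rest = to T-∧ gap ; x∈S , x+2∈S = to T-∧ rest
             in x∈S , to T-not x+1∉S , x+2∈S)
    (λ (x∈S , x+1∉S , x+2∈S) → from T-∧ (from T-not x+1∉S , from T-∧ (x∈S , x+2∈S)))

  ∈-I-ia : ∀ {F i x} → x ∈ I-ia a b F i ⇔ (x ≤ F × IsolatedGap x × x % a ≡ i)
  ∈-I-ia {i = i} = mk⇔
    (λ x∈I → let x∈upTo , cond = to (∈-filterᵇ p) x∈I ; gap , res = to T-∧ cond
             in s≤s⁻¹ (∈-upTo⁻ x∈upTo) , to T-isIsolatedGapᵇ gap , ≡ᵇ⇒≡ _ _ res)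
    (λ (x≤F , gap , res) → from (∈-filterᵇ p)
      (∈-upTo⁺ (s≤s x≤F) , from T-∧ (from T-isIsolatedGapᵇ gap , ≡⇒≡ᵇ _ _ res)))
    where
    p : ℕ → Bool
    p x = isIsolatedGapᵇ a b x ∧ (x % a ≡ᵇ i)

  ∈-alphaInv-Iia⁻ : ∀ {F i s} → s ∈ alphaInv-Iia a b F i → (F ∸ s) % a ≡ i
  ∈-alphaInv-Iia⁻ {F} {i} {s} s∈α =
    let _ , cond = to (∈-filterᵇ p {upTo F}) s∈α ; _ , _ , res = to (T-∧³ {isTᵇ a b F s}) cond
    in ≡ᵇ⇒≡ _ _ res
    where
    p : ℕ → Bool
    p s = isTᵇ a b F s ∧ isIsolatedGapᵇ a b (F ∸ s) ∧ ((F ∸ s) % a ≡ᵇ i)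

  ∈-alphaInv-Iia⁺ : ∀ {F i s} → s < F → T (isTᵇ a b F s) → IsolatedGap (F ∸ s) → (F ∸ s) % a ≡ i →
    s ∈ alphaInv-Iia a b F i
  ∈-alphaInv-Iia⁺ {F} {i} s<F s∈T gap res = from (∈-filterᵇ p)
    (∈-upTo⁺ s<F , from T-∧³ (s∈T , from T-isIsolatedGapᵇ gap , ≡⇒≡ᵇ _ _ res))
    where
    p : ℕ → Bool
    p s = isTᵇ a b F s ∧ isIsolatedGapᵇ a b (F ∸ s) ∧ ((F ∸ s) % a ≡ᵇ i)

  complement∈T : ∀ {F x y} → ¬ InS a b F → F ≡ suc x + y → IsolatedGap (suc x) → InS a b y →
    T (isTᵇ a b F y)
  complement∈T {F} {x} {y} F∉S F≡x+1+y (x∈S , _ , x+2∈S) y∈S =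
    from T-∧ (y∈S , from T-∧ (<⇒<ᵇ y<F , from T-∧
      (pred∉S y F≡x+1+y , from T-not λ y+1∈S → F∉S (subst (InS a b) y+1+x≡F (inS-+ y+1∈S x∈S)))))
    where
    y<F : y < F
    y<F = subst (y <_) (sym F≡x+1+y) (s≤s (m≤n+m y x))
    y+1+x≡F : suc y + x ≡ F
    y+1+x≡F = trans (sym (+-suc y x)) (trans (+-comm y (suc x)) (sym F≡x+1+y))
    pred∉S : ∀ y → F ≡ suc x + y → T (predNotInSᵇ a b y)
    pred∉S zero _ = _
    pred∉S (suc y) F≡x+2+y = from T-not λ y∈S →
      F∉S (subst (InS a b) (trans (shift y x) (sym F≡x+2+y)) (inS-+ y∈S x+2∈S))
      where
      shift : ∀ y x → y + suc (suc x) ≡ suc x + suc y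
      shift = solve-∀

module Gaps (a b c d : ℕ) .⦃ _ : NonZero a ⦄ (coprime : Coprime a b) (1<b : 1 < b) (c<a : c < a)
  (bc≡1+da : b * c ≡ 1 + d * a) where

  open Semigroup a b

  instance
    b-nonZero : NonZero b
    b-nonZero = >-nonZero (<-trans z<s 1<b)

  c≢0 : c ≢ 0
  c≢0 c≡0 = 0≢1+n (trans (sym (*-zeroʳ b)) (subst (λ c → b * c ≡ 1 + d * a) c≡0 bc≡1+da))

  d≢0 : d ≢ 0
  d≢0 d≡0 = <⇒≢ 1<b (sym (m*n≡1⇒m≡1 b c (subst (λ d → b * c ≡ 1 + d * a) d≡0 bc≡1+da)))

  d<b : d < b
  d<b = *-cancelʳ-< a d b (begin-strict
    d * a     <⟨ n<1+n (d * a) ⟩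
    1 + d * a ≡⟨ sym bc≡1+da ⟩
    b * c     <⟨ *-monoʳ-< b c<a ⟩
    b * a     ∎)
    where open ≤-Reasoning

  instance
    d-nonZero : NonZero d
    d-nonZero = ≢-nonZero d≢0

  1<a : 1 < a
  1<a = ≤-<-trans (n≢0⇒n>0 c≢0) c<a

  residue : ℕ → ℕ
  residue t = t * b % a

  a∣r*b⇒r≡0 : ∀ {r} → r < a → a ∣ r * b → r ≡ 0
  a∣r*b⇒r≡0 {zero} _ _ = refl
  a∣r*b⇒r≡0 {suc r} r<a a∣rb =
    contradiction (coprime-divisor coprime (subst (a ∣_) (*-comm (suc r) b) a∣rb)) (>⇒∤ r<a)

  residue-injective : ∀ {t t'} → t < a → t' < a → residue t ≡ residue t' → t ≡ t'
  residue-injective {t} {t'} t<a t'<a eq =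
    [ (λ t≤t' → injective≤ t'<a t≤t' eq)
    , (λ t'≤t → sym (injective≤ t<a t'≤t (sym eq)))
    ]′ (≤-total t t')
    where
    injective≤ : ∀ {t t'} → t' < a → t ≤ t' → residue t ≡ residue t' → t ≡ t'
    injective≤ {t} t'<a t≤t' eq with ≤⇒≤″ t≤t'
    ... | r , refl = sym (trans (cong (t +_) r≡0) (+-identityʳ t))
      where
      r≡0 : r ≡ 0
      r≡0 = a∣r*b⇒r≡0 (≤-<-trans (m≤n+m r t) t'<a)
        ([m+n]%o≡m%o⇒o∣n (t * b) (r * b) a (trans (cong (_% a) (sym (*-distribʳ-+ b t r))) (sym eq)))

  residue-inverse : ∀ n → residue (n * c % a) ≡ n % a
  residue-inverse n = begin
    n * c % a * b % a           ≡⟨ %-distribˡ-* (n * c % a) b a ⟩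
    n * c % a % a * (b % a) % a ≡⟨ cong (λ r → r * (b % a) % a) (m%n%n≡m%n (n * c) a) ⟩
    n * c % a * (b % a) % a     ≡⟨ sym (%-distribˡ-* (n * c) b a) ⟩
    n * c * b % a               ≡⟨ cong (_% a) (trans (*-assoc n c b) (cong (n *_) (trans (*-comm c b) bc≡1+da))) ⟩
    n * (1 + d * a) % a         ≡⟨ cong (_% a) (expand n d a) ⟩
    (n + n * d * a) % a         ≡⟨ [m+kn]%n≡m%n n (n * d) a ⟩
    n % a                       ∎
    where
    open ≡-Reasoning
    expand : ∀ n d a → n * (1 + d * a) ≡ n + n * d * a
    expand = solve-∀

  gapForm⇒∉S : ∀ {n t k} → t < a → n + suc k * a ≡ t * b → ¬ InS a b n
  gapForm⇒∉S {n} {t} {k} t<a n+[k+1]a≡tb n∈S with inS-elim n∈S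
  ... | k' , j , refl with ≤-total j t
  ... | inj₂ t≤j = <-irrefl refl (begin-strict
      j * b                      ≤⟨ m≤n+m (j * b) (k' * a) ⟩
      k' * a + j * b             <⟨ m<m+n _ (≤-trans (>-nonZero⁻¹ a) (m≤m+n a (k * a))) ⟩
      k' * a + j * b + suc k * a ≡⟨ n+[k+1]a≡tb ⟩
      t * b                      ≤⟨ *-monoˡ-≤ b t≤j ⟩
      j * b                      ∎)
    where open ≤-Reasoning
  ... | inj₁ j≤t with ≤⇒≤″ j≤t
  ... | r , refl = 1+n≢0 (m*n≡0⇒m≡0 (suc (k' + k)) a (trans [k'+k+1]a≡rb (cong (_* b) r≡0)))
    where
    regroup : ∀ k' a j b k → j * b + suc (k' + k) * a ≡ k' * a + j * b + suc k * a
    regroup = solve-∀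
    [k'+k+1]a≡rb : suc (k' + k) * a ≡ r * b
    [k'+k+1]a≡rb = +-cancelˡ-≡ (j * b) _ _
      (trans (regroup k' a j b k) (trans n+[k+1]a≡tb (*-distribʳ-+ b j r)))
    r≡0 : r ≡ 0
    r≡0 = a∣r*b⇒r≡0 (≤-<-trans (m≤n+m r j) t<a) (divides (suc (k' + k)) (sym [k'+k+1]a≡rb))

  ∉S⇒gapForm : ∀ {n} → ¬ InS a b n → ∃₂ λ t k → t < a × n + suc k * a ≡ t * b
  ∉S⇒gapForm {n} n∉S = compare (t * b ≤? n)
    where
    t : ℕ
    t = n * c % a
    compare : Dec (t * b ≤ n) → ∃₂ λ t k → t < a × n + suc k * a ≡ t * b
    compare (yes tb≤n) with ≤⇒≤″ tb≤n
    ... | m , tb+m≡n with [m+n]%o≡m%o⇒o∣n (t * b) m a (trans (cong (_% a) tb+m≡n) (sym (residue-inverse n)))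
    ... | divides e refl = contradiction (subst (InS a b) (trans (+-comm (e * a) (t * b)) tb+m≡n) (inS-intro e t)) n∉S
    compare (no tb≰n) with ≤⇒≤″ (<⇒≤ (≰⇒> tb≰n))
    ... | m , n+m≡tb with [m+n]%o≡m%o⇒o∣n n m a (trans (cong (_% a) n+m≡tb) (residue-inverse n))
    ... | divides (suc k) refl = t , k , m%n<n (n * c) a , n+m≡tb
    ... | divides zero refl = contradiction (≤-reflexive (sym (trans (sym (+-identityʳ n)) n+m≡tb))) tb≰n

  a≤pred[a]*b : a ≤ pred a * b
  a≤pred[a]*b = begin
    a                 ≡⟨ sym (suc-pred a) ⟩
    1 + pred a        ≤⟨ +-monoˡ-≤ (pred a) (pred-mono-< 1<a) ⟩
    pred a + pred a   ≡⟨ cong (pred a +_) (sym (+-identityʳ (pred a))) ⟩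
    2 * pred a        ≡⟨ *-comm 2 (pred a) ⟩
    pred a * 2        ≤⟨ *-monoʳ-≤ (pred a) 1<b ⟩
    pred a * b        ∎
    where open ≤-Reasoning

  F+a≡pred[a]*b : ∀ {F} → IsFrobenius a b F → F + a ≡ pred a * b
  F+a≡pred[a]*b {F} (F∉S , >F⇒∈S) with ∉S⇒gapForm F∉S | ≤⇒≤″ a≤pred[a]*b
  ... | t , k , t<a , F+[k+1]a≡tb | N , a+N≡pred[a]b = ≤-antisym F+a≤pred[a]b pred[a]b≤F+a
    where
    open ≤-Reasoning
    F+a≤pred[a]b : F + a ≤ pred a * b
    F+a≤pred[a]b = begin
      F + a         ≤⟨ +-monoʳ-≤ F (m≤m+n a (k * a)) ⟩
      F + suc k * a ≡⟨ F+[k+1]a≡tb ⟩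
      t * b         ≤⟨ *-monoˡ-≤ b (<⇒≤pred t<a) ⟩
      pred a * b    ∎
    N∉S : ¬ InS a b N
    N∉S = gapForm⇒∉S {k = 0} (m≤pred[n]⇒suc[m]≤n ≤-refl)
      (trans (cong (N +_) (+-identityʳ a)) (trans (+-comm N a) a+N≡pred[a]b))
    pred[a]b≤F+a : pred a * b ≤ F + a
    pred[a]b≤F+a = begin
      pred a * b ≡⟨ sym a+N≡pred[a]b ⟩
      a + N      ≤⟨ +-monoʳ-≤ a (≮⇒≥ (λ F<N → N∉S (>F⇒∈S N F<N))) ⟩
      a + F      ≡⟨ +-comm a F ⟩
      F + a      ∎

  gap-complement : ∀ {F x} → IsFrobenius a b F → ¬ InS a b x → ∃ λ y → F ≡ x + y × InS a b y
  gap-complement {F} {x} isFrob x∉S with ∉S⇒gapForm x∉S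
  ... | t , k , t<a , x+[k+1]a≡tb with ≤⇒≤″ (<⇒≤pred t<a)
  ... | r , t+r≡pred[a] = k * a + r * b , F≡x+y , inS-intro k r
    where
    open ≡-Reasoning
    regroup : ∀ x k a r b → x + suc k * a + r * b ≡ x + (k * a + r * b) + a
    regroup = solve-∀
    F≡x+y : F ≡ x + (k * a + r * b)
    F≡x+y = +-cancelʳ-≡ a _ _ (begin
      F + a                        ≡⟨ F+a≡pred[a]*b isFrob ⟩
      pred a * b                   ≡⟨ cong (_* b) (sym t+r≡pred[a]) ⟩
      (t + r) * b                  ≡⟨ *-distribʳ-+ b t r ⟩
      t * b + r * b                ≡⟨ cong (_+ r * b) (sym x+[k+1]a≡tb) ⟩
      x + suc k * a + r * b        ≡⟨ regroup x k a r b ⟩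
      x + (k * a + r * b) + a      ∎)

  -- Using 1 = b c − d a: if t < c then x is the gap (t + a − c) b − (k + b − d + 1) a,
  -- and if t + c < a then x + 2 is the gap (t + c) b − (k + d + 1) a.
  isolatedGap⇒c≤t×a≤t+c : ∀ {x t k} → t < a → suc x + suc k * a ≡ t * b → IsolatedGap (suc x) →
    c ≤ t × a ≤ t + c
  isolatedGap⇒c≤t×a≤t+c {x} {t} {k} t<a x+1+[k+1]a≡tb (x∈S , _ , x+2∈S) = ≮⇒≥ t≮c , ≮⇒≥ t+c≮a
    where
    open ≡-Reasoning
    t≮c : ¬ t < c
    t≮c t<c =
      gapForm⇒∉S {k = k + suc e} (subst (t + a₁ <_) c+a₁≡a (+-monoˡ-< a₁ t<c)) x+[k+e+2]a≡[t+a₁]b x∈S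
      where
      a₁ = a ∸ c
      c+a₁≡a : c + a₁ ≡ a
      c+a₁≡a = m+[n∸m]≡n (<⇒≤ c<a)
      e = b ∸ suc d
      d+1+e≡b : suc d + e ≡ b
      d+1+e≡b = m+[n∸m]≡n d<b
      regroup₁ : ∀ x k e a d → x + suc (k + suc e) * a + (1 + d * a) ≡ (suc x + suc k * a) + a * (suc d + e)
      regroup₁ = solve-∀
      regroup₂ : ∀ t b c a₁ → t * b + (c + a₁) * b ≡ (t + a₁) * b + b * c
      regroup₂ = solve-∀
      x+[k+e+2]a≡[t+a₁]b : x + suc (k + suc e) * a ≡ (t + a₁) * b
      x+[k+e+2]a≡[t+a₁]b = +-cancelʳ-≡ (b * c) _ _ (begin
        x + suc (k + suc e) * a + b * c         ≡⟨ cong (x + suc (k + suc e) * a +_) bc≡1+da ⟩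
        x + suc (k + suc e) * a + (1 + d * a)   ≡⟨ regroup₁ x k e a d ⟩
        (suc x + suc k * a) + a * (suc d + e)   ≡⟨ cong₂ (λ l r → l + a * r) x+1+[k+1]a≡tb d+1+e≡b ⟩
        t * b + a * b                           ≡⟨ cong (λ a → t * b + a * b) (sym c+a₁≡a) ⟩
        t * b + (c + a₁) * b                    ≡⟨ regroup₂ t b c a₁ ⟩
        (t + a₁) * b + b * c                    ∎)
    t+c≮a : ¬ t + c < a
    t+c≮a t+c<a = gapForm⇒∉S {k = k + d} t+c<a (sym [t+c]b≡x+2+[k+d+1]a) x+2∈S
      where
      regroup₁ : ∀ t c b → (t + c) * b ≡ t * b + b * c
      regroup₁ = solve-∀
      regroup₂ : ∀ x k a d → (suc x + suc k * a) + (1 + d * a) ≡ suc (suc x) + suc (k + d) * a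
      regroup₂ = solve-∀
      [t+c]b≡x+2+[k+d+1]a : (t + c) * b ≡ suc (suc x) + suc (k + d) * a
      [t+c]b≡x+2+[k+d+1]a = begin
        (t + c) * b                        ≡⟨ regroup₁ t c b ⟩
        t * b + b * c                      ≡⟨ cong₂ _+_ (sym x+1+[k+1]a≡tb) bc≡1+da ⟩
        (suc x + suc k * a) + (1 + d * a)  ≡⟨ regroup₂ x k a d ⟩
        suc (suc x) + suc (k + d) * a      ∎

  -- The isolated gap is t b − a; its neighbours are (t − c) b + (d − 1) a and (b − d − 1) a + (t + c − a) b.
  c≤t×a≤t+c⇒isolatedGap : ∀ {t} → t < a → c ≤ t → a ≤ t + c →
    ∃ λ x → suc x + a ≡ t * b × IsolatedGap (suc x)
  c≤t×a≤t+c⇒isolatedGap {t} t<a c≤t a≤t+c with ≤⇒≤″ c≤t | ≤⇒≤″ a≤t+c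
  ... | t₁ , refl | t₂ , a+t₂≡t+c =
    x , x+1+a≡tb , subst (InS a b) (+-comm (pred d * a) (t₁ * b)) (inS-intro (pred d) t₁) , x+1∉S , x+2∈S
    where
    open ≡-Reasoning
    x = t₁ * b + pred d * a
    regroup₁ : ∀ t₁ b p a → suc (t₁ * b + p * a) + a ≡ t₁ * b + (1 + suc p * a)
    regroup₁ = solve-∀
    regroup₂ : ∀ t₁ b c → t₁ * b + b * c ≡ (c + t₁) * b
    regroup₂ = solve-∀
    x+1+a≡tb : suc x + a ≡ (c + t₁) * b
    x+1+a≡tb = begin
      suc x + a                        ≡⟨ regroup₁ t₁ b (pred d) a ⟩
      t₁ * b + (1 + suc (pred d) * a)  ≡⟨ cong (λ d → t₁ * b + (1 + d * a)) (suc-pred d) ⟩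
      t₁ * b + (1 + d * a)             ≡⟨ cong (t₁ * b +_) (sym bc≡1+da) ⟩
      t₁ * b + b * c                   ≡⟨ regroup₂ t₁ b c ⟩
      (c + t₁) * b                     ∎
    x+1∉S : ¬ InS a b (suc x)
    x+1∉S = gapForm⇒∉S {k = 0} t<a (trans (cong (suc x +_) (+-identityʳ a)) x+1+a≡tb)
    e = b ∸ suc d
    d+1+e≡b : suc d + e ≡ b
    d+1+e≡b = m+[n∸m]≡n d<b
    regroup₃ : ∀ x a d → suc (suc x) + (a + d * a) ≡ (suc x + a) + (1 + d * a)
    regroup₃ = solve-∀
    regroup₄ : ∀ t b c → t * b + b * c ≡ (t + c) * b
    regroup₄ = solve-∀
    regroup₅ : ∀ a t₂ d e b → a * (suc d + e) + t₂ * b ≡ (e * a + t₂ * b) + (a + d * a)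
    regroup₅ = solve-∀
    x+2≡ea+t₂b : suc (suc x) ≡ e * a + t₂ * b
    x+2≡ea+t₂b = +-cancelʳ-≡ (a + d * a) _ _ (begin
      suc (suc x) + (a + d * a)        ≡⟨ regroup₃ x a d ⟩
      (suc x + a) + (1 + d * a)        ≡⟨ cong₂ _+_ x+1+a≡tb (sym bc≡1+da) ⟩
      (c + t₁) * b + b * c             ≡⟨ regroup₄ (c + t₁) b c ⟩
      (c + t₁ + c) * b                 ≡⟨ cong (_* b) (sym a+t₂≡t+c) ⟩
      (a + t₂) * b                     ≡⟨ *-distribʳ-+ b a t₂ ⟩
      a * b + t₂ * b                   ≡⟨ cong (λ b' → a * b' + t₂ * b) (sym d+1+e≡b) ⟩
      a * (suc d + e) + t₂ * b         ≡⟨ regroup₅ a t₂ d e b ⟩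
      (e * a + t₂ * b) + (a + d * a)   ∎)
    x+2∈S : InS a b (suc (suc x))
    x+2∈S = subst (InS a b) (sym x+2≡ea+t₂b) (inS-intro e t₂)

  t₀ : ℕ
  t₀ = c ⊔ (a ∸ c)

  t₀≤a : t₀ ≤ a
  t₀≤a = ⊔-lub (<⇒≤ c<a) (m∸n≤m a c)

  j<a∸t₀⇔t₀+j<a : ∀ {j} → j < a ∸ t₀ ⇔ t₀ + j < a
  j<a∸t₀⇔t₀+j<a {j} = mk⇔
    (λ j<a∸t₀ → subst (t₀ + j <_) (m+[n∸m]≡n t₀≤a) (+-monoʳ-< t₀ j<a∸t₀))
    (λ t₀+j<a → subst (_< a ∸ t₀) (m+n∸m≡n t₀ j) (∸-monoˡ-< t₀+j<a (m≤m+n t₀ j)))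

  t₀≤t⇔c≤t×a≤t+c : ∀ {t} → t₀ ≤ t ⇔ (c ≤ t × a ≤ t + c)
  t₀≤t⇔c≤t×a≤t+c {t} = mk⇔
    (λ t₀≤t → m⊔n≤o⇒m≤o c (a ∸ c) t₀≤t ,
      subst (_≤ t + c) (m∸n+n≡m (<⇒≤ c<a)) (+-monoˡ-≤ c (m⊔n≤o⇒n≤o c (a ∸ c) t₀≤t)))
    (λ (c≤t , a≤t+c) → ⊔-lub c≤t (m≤n+o⇒m∸n≤o a c (subst (a ≤_) (+-comm t c) a≤t+c)))

  module Counting (F : ℕ) (isFrobenius : IsFrobenius a b F) where

    nonemptyResidues : List ℕ
    nonemptyResidues = filterᵇ (λ i → not (null (I-ia a b F i))) (range1 a)

    nonemptyResidues-unique : Unique nonemptyResidues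
    nonemptyResidues-unique = Unique.filter⁺ _ (Unique.filter⁺ _ (Unique.upTo⁺ a))

    isolatedGapResidues : List ℕ
    isolatedGapResidues = applyUpTo (λ j → residue (t₀ + j)) (a ∸ t₀)

    ∈-nonemptyResidues : ∀ {i} → i ∈ nonemptyResidues ⇔ (1 ≤ i × i < a × ∃ λ x → suc x ∈ I-ia a b F i)
    ∈-nonemptyResidues {i} = mk⇔
      (λ i∈ → let i∈range , nonnull = to (∈-filterᵇ p) i∈ ; 1≤i , i<a = to ∈-range1 i∈range
              in 1≤i , i<a , predecessor (to T-not-null nonnull))
      (λ (1≤i , i<a , x , x+1∈I) →
        from (∈-filterᵇ p) (from ∈-range1 (1≤i , i<a) , from T-not-null (suc x , x+1∈I)))
      where
      p : ℕ → Bool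
      p i = not (null (I-ia a b F i))
      predecessor : ∃ (_∈ I-ia a b F i) → ∃ λ x → suc x ∈ I-ia a b F i
      predecessor (zero , 0∈I) = ⊥-elim (proj₁ (proj₂ (to (∈-I-ia {F}) 0∈I)))
      predecessor (suc x , x+1∈I) = x , x+1∈I

    nonempty⇒isolatedGapResidue : ∀ {i} → i ∈ nonemptyResidues → i ∈ isolatedGapResidues
    nonempty⇒isolatedGapResidue i∈
      with _ , _ , x , x+1∈I ← to ∈-nonemptyResidues i∈
      with _ , gap@(_ , x+1∉S , _) , x+1%a≡i ← to (∈-I-ia {F}) x+1∈I
      with t , k , t<a , x+1+[k+1]a≡tb ← ∉S⇒gapForm x+1∉S
      with c≤t , a≤t+c ← isolatedGap⇒c≤t×a≤t+c {k = k} t<a x+1+[k+1]a≡tb gap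
      with j , refl ← ≤⇒≤″ (from t₀≤t⇔c≤t×a≤t+c (c≤t , a≤t+c))
      = subst (_∈ isolatedGapResidues) residue≡i (∈-applyUpTo⁺ _ (from j<a∸t₀⇔t₀+j<a t<a))
      where
      residue≡i : residue (t₀ + j) ≡ _
      residue≡i = trans (cong (_% a) (sym x+1+[k+1]a≡tb)) (trans ([m+kn]%n≡m%n (suc x) (suc k) a) x+1%a≡i)

    isolatedGapResidue⇒nonempty : ∀ {i} → i ∈ isolatedGapResidues → i ∈ nonemptyResidues
    isolatedGapResidue⇒nonempty i∈
      with j , j<a∸t₀ , refl ← ∈-applyUpTo⁻ _ i∈
      with t<a ← to j<a∸t₀⇔t₀+j<a j<a∸t₀
         | c≤t , a≤t+c ← to t₀≤t⇔c≤t×a≤t+c (m≤m+n t₀ j)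
      with x , x+1+a≡tb , gap@(_ , x+1∉S , _) ← c≤t×a≤t+c⇒isolatedGap t<a c≤t a≤t+c
      = from ∈-nonemptyResidues (n≢0⇒n>0 residue≢0 , m%n<n _ a , x , x+1∈I)
      where
      residue≢0 : residue (t₀ + j) ≢ 0
      residue≢0 r≡0 = c≢0 (n≤0⇒n≡0 (subst (c ≤_) t≡0 c≤t))
        where
        t≡0 : t₀ + j ≡ 0
        t≡0 = residue-injective t<a (>-nonZero⁻¹ a) (trans r≡0 (sym (m<n⇒m%n≡m (>-nonZero⁻¹ a))))
      x+1∈I : suc x ∈ I-ia a b F (residue (t₀ + j))
      x+1∈I = from ∈-I-ia (∉S⇒≤F isFrobenius x+1∉S , gap ,
        trans (sym ([m+n]%n≡m%n (suc x) a)) (cong (_% a) x+1+a≡tb))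

    length-nonemptyResidues : length nonemptyResidues ≡ c ⊓ (a ∸ c)
    length-nonemptyResidues = begin
      length nonemptyResidues           ≡⟨ unique∧set⇒length≡ nonemptyResidues-unique isolatedGapResidues-unique
                                             (mk⇔ nonempty⇒isolatedGapResidue isolatedGapResidue⇒nonempty) ⟩
      length isolatedGapResidues        ≡⟨ length-applyUpTo _ (a ∸ t₀) ⟩
      a ∸ (c ⊔ (a ∸ c))                 ≡⟨ ∸-distribˡ-⊔-⊓ a c (a ∸ c) ⟩
      (a ∸ c) ⊓ (a ∸ (a ∸ c))           ≡⟨ cong ((a ∸ c) ⊓_) (m∸[m∸n]≡n (<⇒≤ c<a)) ⟩
      (a ∸ c) ⊓ c                       ≡⟨ ⊓-comm (a ∸ c) c ⟩
      c ⊓ (a ∸ c)                       ∎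
      where
      open ≡-Reasoning
      isolatedGapResidues-unique : Unique isolatedGapResidues
      isolatedGapResidues-unique = Unique.applyUpTo⁺₁ _ (a ∸ t₀) λ i<j j<a∸t₀ eq →
        <⇒≢ i<j (+-cancelˡ-≡ t₀ _ _ (residue-injective
          (to j<a∸t₀⇔t₀+j<a (<-trans i<j j<a∸t₀)) (to j<a∸t₀⇔t₀+j<a j<a∸t₀) eq))

    α⁻¹ : ℕ → List ℕ
    α⁻¹ = alphaInv-Iia a b F

    α⁻¹-nonempty : ∀ {i} → i ∈ nonemptyResidues → ∃ (_∈ α⁻¹ i)
    α⁻¹-nonempty i∈
      with _ , _ , x , x+1∈I ← to ∈-nonemptyResidues i∈
      with _ , gap@(_ , x+1∉S , _) , x+1%a≡i ← to (∈-I-ia {F}) x+1∈I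
      with y , F≡x+1+y , y∈S ← gap-complement isFrobenius x+1∉S
      = y , ∈-alphaInv-Iia⁺ y<F (complement∈T (proj₁ isFrobenius) F≡x+1+y gap y∈S)
              (subst IsolatedGap (sym F∸y≡x+1) gap) (trans (cong (_% a) F∸y≡x+1) x+1%a≡i)
      where
      F∸y≡x+1 : F ∸ y ≡ suc x
      F∸y≡x+1 = trans (cong (_∸ y) F≡x+1+y) (m+n∸n≡m (suc x) y)
      y<F : y < F
      y<F = subst (y <_) (sym F≡x+1+y) (s≤s (m≤n+m y x))

    -- Each element s of α⁻¹(I_{i,a}) has (F − s) mod a = i, so the head recovers i; the value at [] is junk.
    headResidue : List ℕ → ℕ
    headResidue [] = 0
    headResidue (s ∷ _) = (F ∸ s) % a

    headResidue-α⁻¹ : ∀ {i} → i ∈ nonemptyResidues → headResidue (α⁻¹ i) ≡ i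
    headResidue-α⁻¹ {i} i∈ = headOf (α⁻¹ i) (proj₂ (α⁻¹-nonempty i∈)) ∈-alphaInv-Iia⁻
      where
      headOf : ∀ xs {s} → s ∈ xs → (∀ {s} → s ∈ xs → (F ∸ s) % a ≡ i) → headResidue xs ≡ i
      headOf (s ∷ _) _ residue≡i = residue≡i (here refl)

    length-alphaInvFamily : length (alphaInvFamily a b F) ≡ length nonemptyResidues
    length-alphaInvFamily = begin
      length (alphaInvFamily a b F)      ≡⟨ unique∧set⇒length≡ (deduplicate-! _) α⁻¹-unique
                                              (mk⇔ (∈-deduplicate⁻ _ _) (∈-deduplicate⁺ _)) ⟩
      length (map α⁻¹ nonemptyResidues)  ≡⟨ length-map α⁻¹ nonemptyResidues ⟩
      length nonemptyResidues            ∎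
      where
      open ≡-Reasoning
      recover : map headResidue (map α⁻¹ nonemptyResidues) ≡ nonemptyResidues
      recover = trans (sym (map-∘ nonemptyResidues)) (map-id-local (All.tabulate headResidue-α⁻¹))
      α⁻¹-unique : Unique (map α⁻¹ nonemptyResidues)
      α⁻¹-unique = Unique.map⁻ (subst Unique (sym recover) nonemptyResidues-unique)

lemma3p8 : (a b : ℕ) → .{{_ : NonZero a}} → Coprime a b → 1 < a → a < b →
    (u v : ℤ) → IsDefinitelyLeast a b u v →
    (F : ℕ) → IsFrobenius a b F →
    length (alphaInvFamily a b F) ≡ ∣ v ∣
lemma3p8 a b coprime 1<a a<b u v least F isFrobenius
  with c , d , c<a , bc≡1+da , ∣v∣≡c⊓[a∸c] ← definitelyLeast⇒inverse 1<a (<-trans 1<a a<b) least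
  = begin
    length (alphaInvFamily a b F) ≡⟨ length-alphaInvFamily ⟩
    length nonemptyResidues       ≡⟨ length-nonemptyResidues ⟩
    c ⊓ (a ∸ c)                   ≡⟨ sym ∣v∣≡c⊓[a∸c] ⟩
    ∣ v ∣                         ∎
  where
  open Gaps a b c d coprime (<-trans 1<a a<b) c<a bc≡1+da
  open Counting F isFrobenius
  open ≡-Reasoning
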